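{- Let $G$ be a simple graph with $n$ vertices and $m$ edges, and let $k$ be an integer with $3\leq k\leq n$. Then $\lambda_k(G)=0$ if $m<n-1$, and $\lambda_k(G)\leq \lfloor\frac{2m}{n}\rfloor$ if $m\geq n-1$.
   Context: All graphs are finite, simple and undirected. For a graph $G$ and a vertex set $S\subseteq V(G)$ with $|S|\ge 2$, an $S$-Steiner tree is a subgraph of $G$ which is a tree and contains every vertex of $S$. $\lambda(S)$ denotes the maximum number of pairwise edge-disjoint $S$-Steiner trees in $G$. For an integer $k$ with $2\le k\le |V(G)|$, the generalized $k$-edge-connectivity is $\lambda_k(G)=\min\{\lambda(S): S\subseteq V(G),\ |S|=k\}$, with the convention $\lambda_k(G)=0$ if $G$ is disconnected. -}

module Defs where

open import Data.Nat using (ℕ; zero; suc; _+_; _*_; _≤_; _<_; _<ᵇ_)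
open import Data.Nat.DivMod using (_/_)
open import Data.Bool using (Bool; true; false; _∧_; if_then_else_)
open import Data.Fin using (Fin; toℕ)
open import Data.Fin.Subset using (Subset; _∈_; ∣_∣)
open import Data.List using (List; []; _∷_; _++_; [_]; length; map; allFin)
open import Data.Nat.ListAction using (sum)
open import Data.List.Relation.Unary.Unique.Propositional using (Unique)
open import Data.Product using (Σ; _×_; ∃)
open import Relation.Nullary using (¬_)
open import Relation.Binary.PropositionalEquality using (_≡_; _≢_)

record Graph (n : ℕ) : Set where
  field
    adj     : Fin n → Fin n → Bool
    adj-sym : ∀ u v → adj u v ≡ adj v u
    adj-irr : ∀ u → adj u u ≡ false
open Graph public

edgeCount : ∀ {n} → Graph n → ℕ
edgeCount {n} G =
  sum (map (λ u → sum (map (λ v →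
    if (toℕ u <ᵇ toℕ v) ∧ adj G u v then 1 else 0) (allFin n))) (allFin n))

data Walk {n : ℕ} (E : Fin n → Fin n → Bool) : Fin n → Fin n → Set where
  here : ∀ {u} → Walk E u u
  step : ∀ {u w v} → E u w ≡ true → Walk E w v → Walk E u v

Connected : ∀ {n} → Graph n → Set
Connected G = ∀ u v → Walk (adj G) u v

data Chain {n : ℕ} (E : Fin n → Fin n → Bool) : List (Fin n) → Set where
  nil  : Chain E []
  one  : ∀ {x} → Chain E (x ∷ [])
  cons : ∀ {x y xs} → E x y ≡ true → Chain E (y ∷ xs) → Chain E (x ∷ y ∷ xs)

Cycle : ∀ {n} → (Fin n → Fin n → Bool) → Set
Cycle {n} E = Σ (Fin n) λ x → Σ (List (Fin n)) λ vs →
  (2 ≤ length vs) × Unique (x ∷ vs) × Chain E (x ∷ vs ++ [ x ])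

record SteinerTree {n : ℕ} (G : Graph n) (S : Subset n) : Set where
  field
    V       : Subset n
    E       : Fin n → Fin n → Bool
    E-sym   : ∀ u v → E u v ≡ E v u
    E⊆G     : ∀ u v → E u v ≡ true → adj G u v ≡ true
    E-ends  : ∀ u v → E u v ≡ true → u ∈ V
    S⊆V     : ∀ u → u ∈ S → u ∈ V
    conn    : ∀ u v → u ∈ V → v ∈ V → Walk E u v
    acyclic : ¬ Cycle E
open SteinerTree public

EdgeDisjointSteinerTrees : ∀ {n} → Graph n → Subset n → ℕ → Set
EdgeDisjointSteinerTrees G S t =
  Σ (Fin t → SteinerTree G S) λ T →
    ∀ i j → i ≢ j → ∀ u v → ¬ (E (T i) u v ≡ true × E (T j) u v ≡ true)

-- λ(S) ≤ c  :⇔  there are no c+1 pairwise edge-disjoint S-Steiner trees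
λS≤ : ∀ {n} → Graph n → Subset n → ℕ → Set
λS≤ G S c = ¬ EdgeDisjointSteinerTrees G S (suc c)

-- λ_k(G) ≤ c : either G is disconnected (λ_k(G) = 0 by convention), or
-- the minimum over |S| = k of λ(S) is ≤ c, i.e. some S with |S| = k has λ(S) ≤ c.
λk≤ : ∀ {n} → Graph n → ℕ → ℕ → Set
λk≤ {n} G k c = (¬ Connected G) Data.Sum.⊎ (Σ (Subset n) λ S → (∣ S ∣ ≡ k) × λS≤ G S c)
  where import Data.Sum

-- floor division, with the (irrelevant here) convention a /′ 0 = 0
_/′_ : ℕ → ℕ → ℕ
a /′ zero = 0
a /′ suc d = a / suc d

-- A connected graph has at least n − 1 edges: ranking the vertices by their
-- distance to a root, every other vertex has a neighbour of smaller rank, and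
-- these "rising" edges are distinct.  So m < n − 1 forces G to be
-- disconnected.  For the upper bound, every S-Steiner tree for an S that
-- contains w and some other vertex must use an edge at w, so edge-disjoint
-- trees use distinct edges at w; taking w of minimum degree, and S of size k
-- around it, gives λ(S) ≤ δ(G) ≤ ⌊2m/n⌋ by the handshake lemma.
module Submission where

open import Defs
open import Data.Nat using (ℕ; zero; suc; _+_; _*_; _∸_; _≤_; _<_; _≥_; _<ᵇ_; z≤n; s≤s; >-nonZero⁻¹)
open import Data.Nat.Properties
open import Data.Nat.DivMod using (_/_; m*n/n≡m; /-monoˡ-≤)
open import Data.Nat.ListAction as ListAction using ()
open import Data.Bool using (Bool; true; false; _∧_; _∨_; T; if_then_else_)
open import Data.Bool.Properties using (T-≡; T-∧; T-∨)
open import Data.Fin as Fin using (Fin; punchIn; punchOut)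
open import Data.Fin.Properties as Fin
  using (any?; punchIn-injective; punchInᵢ≢i; punchIn-punchOut; punchOut-injective)
open import Data.Fin.Subset using (Subset; _∈_; ∣_∣; inside; outside; Nonempty)
open import Data.Vec using ([]; _∷_; here; there)
open import Data.Vec.Functional using (removeAt)
open import Data.List using (tabulate; map; allFin)
open import Data.List.Properties using (map-tabulate)
open import Data.Product using (_×_; ∃; _,_; proj₁; proj₂)
open import Data.Sum using (inj₁; inj₂)
open import Data.Empty using (⊥-elim)
open import Relation.Nullary using (¬_; Dec; yes; no; isYes)
open import Relation.Nullary.Decidable using (T?; toWitness; fromWitness)
open import Relation.Binary.PropositionalEquality
open import Relation.Binary.Definitions using (tri<; tri≈; tri>)
open import Function using (_∘_; id)
open import Function.Bundles using (module Equivalence)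
open import Function.Definitions using (Injective)
open import Algebra.Properties.CommutativeMonoid.Sum +-0-commutativeMonoid
  using (sum; sum-syntax; sum-cong-≗; sum-remove; ∑-comm; ∑-distrib-+)

open Equivalence using (to; from)

sum-tabulate : ∀ {n} (f : Fin n → ℕ) → ListAction.sum (tabulate f) ≡ sum f
sum-tabulate {zero}  f = refl
sum-tabulate {suc n} f = cong (f Fin.zero +_) (sum-tabulate (f ∘ Fin.suc))

sum-map-allFin : ∀ {n} (f : Fin n → ℕ) → ListAction.sum (map f (allFin n)) ≡ sum f
sum-map-allFin {n} f = trans (cong ListAction.sum (map-tabulate id f)) (sum-tabulate f)

sum-mono-≤ : ∀ {n} {f g : Fin n → ℕ} → (∀ i → f i ≤ g i) → sum f ≤ sum g
sum-mono-≤ {zero}  f≤g = z≤n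
sum-mono-≤ {suc n} f≤g = +-mono-≤ (f≤g Fin.zero) (sum-mono-≤ (f≤g ∘ Fin.suc))

term≤sum : ∀ {n} (f : Fin n → ℕ) i → f i ≤ sum f
term≤sum {suc n} f i = subst (f i ≤_) (sym (sum-remove {i = i} f)) (m≤m+n (f i) _)

injective⇒≤sum : ∀ {t n} (f : Fin t → Fin n) (g : Fin n → ℕ) →
  Injective _≡_ _≡_ f → (∀ i → 1 ≤ g (f i)) → t ≤ sum g
injective⇒≤sum {zero}          f g inj pos = z≤n
injective⇒≤sum {suc t} {zero}  f g inj pos = ⊥-elim (Fin.¬Fin0 (f Fin.zero))
injective⇒≤sum {suc t} {suc n} f g inj pos =
  subst (suc t ≤_) (sym (sum-remove {i = f₀} g))
    (+-mono-≤ (pos Fin.zero) (injective⇒≤sum f′ (removeAt g f₀) f′-injective f′-pos))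
  where
  f₀ = f Fin.zero
  f₀≢ : ∀ i → f₀ ≢ f (Fin.suc i)
  f₀≢ i = Fin.0≢1+n ∘ inj
  f′ : Fin t → Fin n
  f′ i = punchOut (f₀≢ i)
  f′-injective : Injective _≡_ _≡_ f′
  f′-injective {i} {j} = Fin.suc-injective ∘ inj ∘ punchOut-injective (f₀≢ i) (f₀≢ j)
  f′-pos : ∀ i → 1 ≤ removeAt g f₀ (f′ i)
  f′-pos i = subst (λ x → 1 ≤ g x) (sym (punchIn-punchOut (f₀≢ i))) (pos (Fin.suc i))

positive-except⇒≤sum : ∀ {n} (g : Fin (suc n) → ℕ) r →
  (∀ i → i ≢ r → 1 ≤ g i) → n ≤ sum g
positive-except⇒≤sum g r pos =
  injective⇒≤sum (punchIn r) g (punchIn-injective r _ _) (λ i → pos _ (punchInᵢ≢i r i))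

∃-term≤average : ∀ {n} (f : Fin (suc n) → ℕ) → ∃ λ i → suc n * f i ≤ sum f
∃-term≤average {zero}  f = Fin.zero , ≤-refl
∃-term≤average {suc n} f with ∃-term≤average (f ∘ Fin.suc)
... | i , avg with f Fin.zero ≤? f (Fin.suc i)
...   | yes f₀≤ = Fin.zero , +-monoʳ-≤ (f Fin.zero) (≤-trans (*-monoʳ-≤ (suc n) f₀≤) avg)
...   | no  f₀≰ = Fin.suc i , +-mono-≤ (<⇒≤ (≰⇒> f₀≰)) avg

firstTrue : (ℕ → Bool) → ℕ → ℕ
firstTrue p zero    = zero
firstTrue p (suc N) with p zero
... | true  = zero
... | false = suc (firstTrue (p ∘ suc) N)

firstTrue-true : ∀ (p : ℕ → Bool) N → T (p N) → T (p (firstTrue p N))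
firstTrue-true p zero    pN = pN
firstTrue-true p (suc N) pN with p zero in p₀
... | true  = subst T (sym p₀) _
... | false = firstTrue-true (p ∘ suc) N pN

firstTrue-minimal : ∀ (p : ℕ → Bool) N k → T (p k) → firstTrue p N ≤ k
firstTrue-minimal p zero    k       pk = z≤n
firstTrue-minimal p (suc N) k       pk with p zero in p₀
... | true  = z≤n
firstTrue-minimal p (suc N) zero    pk | false = ⊥-elim (subst T p₀ pk)
firstTrue-minimal p (suc N) (suc k) pk | false = s≤s (firstTrue-minimal (p ∘ suc) N k pk)

1≤∣p∣⇒Nonempty : ∀ {n} (p : Subset n) → 1 ≤ ∣ p ∣ → Nonempty p
1≤∣p∣⇒Nonempty (inside  ∷ p) _    = Fin.zero , here
1≤∣p∣⇒Nonempty (outside ∷ p) 1≤∣p∣ with 1≤∣p∣⇒Nonempty p 1≤∣p∣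
... | x , x∈p = Fin.suc x , there x∈p

∃-subset-of-size : ∀ {n k} → k ≤ n → ∃ λ (p : Subset n) → ∣ p ∣ ≡ k
∃-subset-of-size {zero}  z≤n = [] , refl
∃-subset-of-size {suc n} z≤n with ∃-subset-of-size z≤n
... | p , ∣p∣≡0 = outside ∷ p , ∣p∣≡0
∃-subset-of-size {suc n} (s≤s k≤n) with ∃-subset-of-size k≤n
... | p , ∣p∣≡k = inside ∷ p , cong suc ∣p∣≡k

∃-subset-of-size-∋ : ∀ {n k} (w : Fin n) → 1 ≤ k → k ≤ n →
  ∃ λ (p : Subset n) → ∣ p ∣ ≡ k × w ∈ p
∃-subset-of-size-∋ Fin.zero (s≤s _) (s≤s k≤n) with ∃-subset-of-size k≤n
... | p , ∣p∣≡k = inside ∷ p , cong suc ∣p∣≡k , here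
∃-subset-of-size-∋ {suc n} {k} (Fin.suc w) 1≤k k≤1+n with k ≤? n
... | yes k≤n with ∃-subset-of-size-∋ w 1≤k k≤n
...   | p , ∣p∣≡k , w∈p = outside ∷ p , ∣p∣≡k , there w∈p
∃-subset-of-size-∋ {suc n} {k} (Fin.suc w) 1≤k k≤1+n | no k≰n
  with ∃-subset-of-size-∋ w (>-nonZero⁻¹ n {{Fin.nonZeroIndex w}}) ≤-refl
... | p , ∣p∣≡n , w∈p =
  inside ∷ p , trans (cong suc ∣p∣≡n) (≤-antisym (≰⇒> k≰n) k≤1+n) , there w∈p

∃-other-member : ∀ {n} (p : Subset n) {w} → w ∈ p → 2 ≤ ∣ p ∣ → ∃ λ x → x ∈ p × x ≢ w
∃-other-member (inside ∷ p) here (s≤s 1≤∣p∣) with 1≤∣p∣⇒Nonempty p 1≤∣p∣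
... | x , x∈p = Fin.suc x , there x∈p , λ ()
∃-other-member (inside ∷ p) (there _) _ = Fin.zero , here , λ ()
∃-other-member (outside ∷ p) (there w∈p) 2≤∣p∣ with ∃-other-member p w∈p 2≤∣p∣
... | x , x∈p , x≢w = Fin.suc x , there x∈p , x≢w ∘ Fin.suc-injective

-- Written with if_then_else_ so that it matches the summands of edgeCount definitionally.
ind : Bool → ℕ
ind b = if b then 1 else 0

T⇒1≤ind : ∀ {b} → T b → 1 ≤ ind b
T⇒1≤ind {true} _ = ≤-refl

<ᵇ-asym : ∀ m n → ¬ (T (m <ᵇ n) × T (n <ᵇ m))
<ᵇ-asym m n (m<n , n<m) = <-asym (<ᵇ⇒< m n m<n) (<ᵇ⇒< n m n<m)

exclusive-pair≤ : ∀ b c e → ¬ (T b × T c) → ind (b ∧ e) + ind (c ∧ e) ≤ ind e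
exclusive-pair≤ true  true  e     excl = ⊥-elim (excl _)
exclusive-pair≤ true  false false _    = z≤n
exclusive-pair≤ true  false true  _    = ≤-refl
exclusive-pair≤ false true  e     _    = ≤-refl
exclusive-pair≤ false false e     _    = z≤n

exclusive-pair≡ : ∀ b c e → ¬ (T b × T c) → (T e → T (b ∨ c)) →
  ind (b ∧ e) + ind (c ∧ e) ≡ ind e
exclusive-pair≡ true  true  e     excl _     = ⊥-elim (excl _)
exclusive-pair≡ true  false false _    _     = refl
exclusive-pair≡ true  false true  _    _     = refl
exclusive-pair≡ false true  e     _    _     = refl
exclusive-pair≡ false false false _    _     = refl
exclusive-pair≡ false false true  _    cover = ⊥-elim (cover _)

module _ {n} (G : Graph n) where

  degree : Fin n → ℕ
  degree u = ∑[ v < n ] ind (adj G u v)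

  rising : (Fin n → ℕ) → Fin n → Fin n → Bool
  rising ρ u v = (ρ u <ᵇ ρ v) ∧ adj G u v

  -- Each edge is counted at most once, and exactly once when ρ is injective.
  risingEdges : (Fin n → ℕ) → ℕ
  risingEdges ρ = ∑[ u < n ] ∑[ v < n ] ind (rising ρ u v)

  edgeCount≡risingEdges-toℕ : edgeCount G ≡ risingEdges Fin.toℕ
  edgeCount≡risingEdges-toℕ =
    trans (sum-map-allFin {n} _) (sum-cong-≗ {n} (λ u → sum-map-allFin {n} _))

  rising-pair : (Fin n → ℕ) → Fin n → Fin n → ℕ
  rising-pair ρ u v = ind (rising ρ u v) + ind (rising ρ v u)

  rising-pair≤ : ∀ ρ (u v : Fin n) → rising-pair ρ u v ≤ ind (adj G u v)
  rising-pair≤ ρ u v =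
    subst (λ e → ind (rising ρ u v) + ind ((ρ v <ᵇ ρ u) ∧ e) ≤ ind (adj G u v)) (adj-sym G u v)
      (exclusive-pair≤ (ρ u <ᵇ ρ v) (ρ v <ᵇ ρ u) (adj G u v) (<ᵇ-asym (ρ u) (ρ v)))

  rising-pair≡ : ∀ (ρ : Fin n → ℕ) → Injective _≡_ _≡_ ρ →
    ∀ u v → rising-pair ρ u v ≡ ind (adj G u v)
  rising-pair≡ ρ ρ-inj u v =
    subst (λ e → ind (rising ρ u v) + ind ((ρ v <ᵇ ρ u) ∧ e) ≡ ind (adj G u v)) (adj-sym G u v)
      (exclusive-pair≡ (ρ u <ᵇ ρ v) (ρ v <ᵇ ρ u) (adj G u v) (<ᵇ-asym (ρ u) (ρ v)) comparable)
    where
    comparable : T (adj G u v) → T ((ρ u <ᵇ ρ v) ∨ (ρ v <ᵇ ρ u))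
    comparable uv with <-cmp (ρ u) (ρ v)
    ... | tri< ρu<ρv _ _ = from T-∨ (inj₁ (<⇒<ᵇ ρu<ρv))
    ... | tri> _ _ ρv<ρu = from T-∨ (inj₂ (<⇒<ᵇ ρv<ρu))
    ... | tri≈ _ ρu≡ρv _ rewrite ρ-inj ρu≡ρv = ⊥-elim (subst T (adj-irr G v) uv)

  twice-risingEdges : ∀ (ρ : Fin n → ℕ) →
    risingEdges ρ + risingEdges ρ ≡ ∑[ u < n ] ∑[ v < n ] rising-pair ρ u v
  twice-risingEdges ρ = begin
    risingEdges ρ + risingEdges ρ
      ≡⟨ cong (risingEdges ρ +_) (∑-comm (λ u v → ind (rising ρ u v))) ⟩
    risingEdges ρ + ∑[ u < n ] ∑[ v < n ] ind (rising ρ v u)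
      ≡⟨ sym (∑-distrib-+ (λ u → ∑[ v < n ] ind (rising ρ u v)) _) ⟩
    ∑[ u < n ] (∑[ v < n ] ind (rising ρ u v) + ∑[ v < n ] ind (rising ρ v u))
      ≡⟨ sum-cong-≗ {n} (λ u → sym (∑-distrib-+ (λ v → ind (rising ρ u v)) _)) ⟩
    ∑[ u < n ] ∑[ v < n ] rising-pair ρ u v ∎
    where open ≡-Reasoning

  twice-risingEdges≤ : ∀ (ρ : Fin n → ℕ) → risingEdges ρ + risingEdges ρ ≤ sum degree
  twice-risingEdges≤ ρ rewrite twice-risingEdges ρ =
    sum-mono-≤ (λ u → sum-mono-≤ (rising-pair≤ ρ u))

  twice-risingEdges≡ : ∀ (ρ : Fin n → ℕ) → Injective _≡_ _≡_ ρ →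
    risingEdges ρ + risingEdges ρ ≡ sum degree
  twice-risingEdges≡ ρ ρ-inj = trans (twice-risingEdges ρ)
    (sum-cong-≗ {n} (λ u → sum-cong-≗ {n} (rising-pair≡ ρ ρ-inj u)))

  twice-edgeCount : edgeCount G + edgeCount G ≡ sum degree
  twice-edgeCount = begin
    edgeCount G + edgeCount G
      ≡⟨ cong₂ _+_ edgeCount≡risingEdges-toℕ edgeCount≡risingEdges-toℕ ⟩
    risingEdges Fin.toℕ + risingEdges Fin.toℕ
      ≡⟨ twice-risingEdges≡ Fin.toℕ Fin.toℕ-injective ⟩
    sum degree ∎
    where open ≡-Reasoning

  handshake : sum degree ≡ 2 * edgeCount G
  handshake = trans (sym twice-edgeCount) (cong (edgeCount G +_) (sym (+-identityʳ _)))

  risingEdges≤edgeCount : ∀ (ρ : Fin n → ℕ) → risingEdges ρ ≤ edgeCount G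
  risingEdges≤edgeCount ρ = ≮⇒≥ λ m<r → <⇒≱ (+-mono-< m<r m<r)
    (subst (risingEdges ρ + risingEdges ρ ≤_) (sym twice-edgeCount) (twice-risingEdges≤ ρ))

descending⇒≤risingEdges : ∀ {n} (G : Graph (suc n)) ρ r →
  (∀ v → v ≢ r → ∃ λ u → ρ u < ρ v × T (adj G u v)) → n ≤ risingEdges G ρ
descending⇒≤risingEdges {n} G ρ r descends =
  subst (n ≤_) (sym (∑-comm (λ u v → ind (rising G ρ u v))))
    (positive-except⇒≤sum (λ v → ∑[ u < suc n ] ind (rising G ρ u v)) r λ v v≢r →
      let (u , ρu<ρv , uv) = descends v v≢r in
      ≤-trans (T⇒1≤ind (from T-∧ (<⇒<ᵇ ρu<ρv , uv)))
              (term≤sum (λ u → ind (rising G ρ u v)) u))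

walkLength : ∀ {n} {E : Fin n → Fin n → Bool} {u v} → Walk E u v → ℕ
walkLength here       = zero
walkLength (step _ p) = suc (walkLength p)

module BreadthFirst {n} (G : Graph n) (connected : Connected G) (r : Fin n) where

  mutual
    within : ℕ → Fin n → Bool
    within zero    v = isYes (v Fin.≟ r)
    within (suc k) v = within k v ∨ isYes (neighbourWithin? k v)

    neighbourWithin? : ∀ k v → Dec (∃ λ u → T (adj G v u ∧ within k u))
    neighbourWithin? k v = any? λ u → T? (adj G v u ∧ within k u)

  walk⇒within : ∀ {v} (p : Walk (adj G) v r) → T (within (walkLength p) v)
  walk⇒within here = fromWitness refl
  walk⇒within {v} (step {w = u} vu p) = from (T-∨ {within (walkLength p) v})
    (inj₂ (fromWitness {a? = neighbourWithin? (walkLength p) v}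
      (u , from T-∧ (from T-≡ vu , walk⇒within p))))

  distance : Fin n → ℕ
  distance v = firstTrue (λ k → within k v) (walkLength (connected v r))

  within-distance : ∀ v → T (within (distance v) v)
  within-distance v =
    firstTrue-true (λ k → within k v) (walkLength (connected v r)) (walk⇒within (connected v r))

  distance-minimal : ∀ v k → T (within k v) → distance v ≤ k
  distance-minimal v = firstTrue-minimal (λ k → within k v) (walkLength (connected v r))

  distance-descends : ∀ v → v ≢ r → ∃ λ u → distance u < distance v × T (adj G u v)
  distance-descends v v≢r = descend (distance v) (within-distance v) (distance-minimal v)
    where
    descend : ∀ d → T (within d v) → (∀ k → T (within k v) → d ≤ k) →
      ∃ λ u → distance u < d × T (adj G u v)
    descend zero    reached _ = ⊥-elim (v≢r (toWitness reached))
    descend (suc j) reached least with to (T-∨ {within j v}) reached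
    ... | inj₁ earlier = ⊥-elim (1+n≰n (least j earlier))
    ... | inj₂ viaNeighbour with toWitness {a? = neighbourWithin? j v} viaNeighbour
    ...   | u , vu∧uj with to T-∧ vu∧uj
    ...     | vu , uj = u , s≤s (distance-minimal u j uj) , subst T (adj-sym G v u) vu

connected⇒n∸1≤edgeCount : ∀ {n} (G : Graph n) → Connected G → n ∸ 1 ≤ edgeCount G
connected⇒n∸1≤edgeCount {zero}  G connected = z≤n
connected⇒n∸1≤edgeCount {suc n} G connected =
  ≤-trans (descending⇒≤risingEdges G distance Fin.zero distance-descends)
          (risingEdges≤edgeCount G distance)
  where open BreadthFirst G connected Fin.zero

walk-first-edge : ∀ {n} {E : Fin n → Fin n → Bool} {u v} → Walk E u v → u ≢ v →
  ∃ λ y → E u y ≡ true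
walk-first-edge here            u≢u = ⊥-elim (u≢u refl)
walk-first-edge (step {w = y} e _) _ = y , e

edgeDisjointSteinerTrees≤degree : ∀ {n} (G : Graph n) {S w x} → w ∈ S → x ∈ S → x ≢ w →
  ∀ {t} → EdgeDisjointSteinerTrees G S t → t ≤ degree G w
edgeDisjointSteinerTrees≤degree G {S} {w} {x} w∈S x∈S x≢w (trees , disjoint) =
  injective⇒≤sum neighbour (λ y → ind (adj G w y)) neighbour-injective neighbour-adjacent
  where
  first-edge : ∀ i → ∃ λ y → E (trees i) w y ≡ true
  first-edge i = walk-first-edge
    (conn (trees i) w x (S⊆V (trees i) w w∈S) (S⊆V (trees i) x x∈S)) (x≢w ∘ sym)
  neighbour = proj₁ ∘ first-edge
  neighbour-injective : Injective _≡_ _≡_ neighbour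
  neighbour-injective {i} {j} same with i Fin.≟ j
  ... | yes i≡j = i≡j
  ... | no  i≢j = ⊥-elim (disjoint i j i≢j w (neighbour i) (proj₂ (first-edge i) ,
        subst (λ y → E (trees j) w y ≡ true) (sym same) (proj₂ (first-edge j))))
  neighbour-adjacent : ∀ i → 1 ≤ ind (adj G w (neighbour i))
  neighbour-adjacent i =
    T⇒1≤ind (from T-≡ (E⊆G (trees i) w (neighbour i) (proj₂ (first-edge i))))

∃-degree≤average : ∀ {n} (G : Graph (suc n)) →
  ∃ λ w → degree G w ≤ (2 * edgeCount G) /′ suc n
∃-degree≤average {n} G with ∃-term≤average (degree G)
... | w , average = w , subst (_≤ 2 * edgeCount G / suc n) (m*n/n≡m (degree G w) (suc n))
  (/-monoˡ-≤ (suc n) (subst₂ _≤_ (*-comm (suc n) (degree G w)) (handshake G) average))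

corollary2 : ∀ {n} (G : Graph n) (k : ℕ) → 3 ≤ k → k ≤ n →
    (edgeCount G < n ∸ 1 → λk≤ G k 0)
    × (edgeCount G ≥ n ∸ 1 → λk≤ G k ((2 * edgeCount G) /′ n))
corollary2 {zero} G k 3≤k k≤0 with ≤-trans 3≤k k≤0
... | ()
corollary2 {suc n} G k 3≤k k≤n
  with w , δ≤2m/n ← ∃-degree≤average G
  with S , ∣S∣≡k , w∈S ← ∃-subset-of-size-∋ w (≤-trans (s≤s z≤n) 3≤k) k≤n
  with x , x∈S , x≢w ← ∃-other-member S w∈S
                          (subst (2 ≤_) (sym ∣S∣≡k) (≤-trans (s≤s (s≤s z≤n)) 3≤k))
  = (λ m<n-1 → inj₁ λ connected → <⇒≱ m<n-1 (connected⇒n∸1≤edgeCount G connected))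
  -- the bound λ(S) ≤ δ(G) ≤ ⌊2m/n⌋ holds without the hypothesis m ≥ n − 1
  , λ _ → inj₂ (S , ∣S∣≡k , λ trees →
      <⇒≱ (s≤s δ≤2m/n) (edgeDisjointSteinerTrees≤degree G w∈S x∈S x≢w trees))
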